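{- For every information lossless pushdown compressor $C$ (respectively, every information lossless unary-stack pushdown compressor $C$) and every information lossless finite-state transducer $T$, there exists an information lossless pushdown compressor (respectively, an information lossless unary-stack pushdown compressor) $N$ such that $N(x)=C(T(x))$ for all $x\in\{0,1\}^*$.
   Context: An FST is $T=(Q,q_0,\delta,\nu)$ with $\delta:Q\times\{0,1\}\to Q$, $\nu:Q\times\{0,1\}\to\{0,1\}^*$, output $T(\lambda)=\lambda$, $T(xb)=T(x)\nu(\widehat\delta(x),b)$ where $\widehat\delta$ is the extended transition function from $q_0$; $T$ is information lossless (ILFST) if $x\mapsto(T(x),\widehat\delta(x))$ is injective. A pushdown compressor (PDC) is a tuple $C=(Q,\Gamma,\delta,\nu,q_0,z_0,c)$ with $Q$ finite, stack alphabet $\Gamma=\{0,1,z_0\}$, partial transition function $\delta:Q\times(\{0,1\}\cup\{\lambda\})\times\Gamma\to Q\times\Gamma^*$ (replacing the top stack symbol by a string; $z_0$ is never removed from the bottom), output function $\nu:Q\times(\{0,1\}\cup\{\lambda\})\times\Gamma\to\{0,1\}^*$, initial state $q_0$, bottom symbol $z_0$, and a bound $c\in\mathbb N$ on the number of consecutive $\lambda$-transitions (transitions reading no input, which pop the top symbol and output $\lambda$); for each $q,a$ either $\delta(q,\lambda,a)$ is undefined or $\delta(q,b,a)$ is undefined for both $b\in\{0,1\}$. After each input bit, $\lambda$-transitions are applied while defined. $C(w)$ is the total output on input $w$ from $q_0$ with stack $z_0$, and $\delta_Q(w)$ the final state; $C$ is information lossless if $w\mapsto(C(w),\delta_Q(w))$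 is injective. A unary-stack PDC is a PDC with stack alphabet $\Gamma=\{0,z_0\}$. -}

module Defs where

open import Data.Nat using (ℕ; zero; suc)
open import Data.Fin using (Fin)
open import Data.Bool using (Bool)
open import Data.List using (List; []; _∷_; _++_; [_])
open import Data.Maybe using (Maybe; just; nothing)
open import Data.Product using (Σ; _×_; _,_; ∃)
open import Data.Sum using (_⊎_)
open import Data.Unit using (⊤)
open import Data.Empty using (⊥)
open import Relation.Binary.PropositionalEquality using (_≡_)

-- Bits: false = 0, true = 1.  Binary strings: List Bool (first element = first bit).
Bit : Set
Bit = Bool

Str : Set
Str = List Bit

record FST : Set where
  field
    nQ : ℕ
    q₀ : Fin nQ
    δ  : Fin nQ → Bit → Fin nQ
    ν  : Fin nQ → Bit → Str

module _ (T : FST) where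
  open FST T

  runFST : Fin nQ → Str → Str × Fin nQ
  runFST q []       = [] , q
  runFST q (b ∷ x) with runFST (δ q b) x
  ... | o , q' = ν q b ++ o , q'

  fstOut : Str → Str
  fstOut x = Data.Product.proj₁ (runFST q₀ x)

  fstState : Str → Fin nQ
  fstState x = Data.Product.proj₂ (runFST q₀ x)

ILFST : FST → Set
ILFST T = ∀ x y → fstOut T x ≡ fstOut T y → fstState T x ≡ fstState T y → x ≡ y

-- The input symbol of a transition is  Maybe Bit  (nothing = λ).
-- δ is partial: Maybe (state , replacement string for the top symbol).

-- k consecutive λ-transitions are possible from state q with stack s
-- (λ-transitions pop the top symbol).
LamChain : {Q Γ : Set} → (Q → Maybe Bit → Γ → Maybe (Q × List Γ)) →
           Q → List Γ → ℕ → Set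
LamChain δ q s       zero    = ⊤
LamChain δ q []      (suc k) = ⊥
LamChain δ q (a ∷ s) (suc k) =
  Σ _ λ q' → Σ _ λ v → (δ q nothing a ≡ just (q' , v)) × LamChain δ q' s k

record PDC (Γ : Set) (z₀ : Γ) : Set where
  field
    nQ : ℕ
    δ  : Fin nQ → Maybe Bit → Γ → Maybe (Fin nQ × List Γ)
    ν  : Fin nQ → Maybe Bit → Γ → Str
    q₀ : Fin nQ
    c  : ℕ
    det      : ∀ q a → (δ q nothing a ≡ nothing) ⊎ (∀ b → δ q (just b) a ≡ nothing)
    lam-pop  : ∀ q a q' v → δ q nothing a ≡ just (q' , v) → v ≡ []
    lam-out  : ∀ q a → ν q nothing a ≡ []
    bottom   : ∀ q x q' v → δ q x z₀ ≡ just (q' , v) → ∃ λ u → v ≡ u ++ [ z₀ ]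
    lam-bound : ∀ q s → LamChain δ q s (suc c) → ⊥

module _ {Γ : Set} {z₀ : Γ} (C : PDC Γ z₀) where
  open PDC C

  -- apply λ-transitions while defined (each pops, so recursion on the stack)
  lamClose : Fin nQ → List Γ → Fin nQ × List Γ
  lamClose q []      = q , []
  lamClose q (a ∷ s) with δ q nothing a
  ... | just (q' , _) = lamClose q' s
  ... | nothing       = q , a ∷ s

  stepPDC : Fin nQ → List Γ → Bit → Maybe (Str × Fin nQ × List Γ)
  stepPDC q []      b = nothing
  stepPDC q (a ∷ s) b with δ q (just b) a
  ... | nothing        = nothing
  ... | just (q' , v)  with lamClose q' (v ++ s)
  ...   | q'' , s'' = just (ν q (just b) a , q'' , s'')

  runPDC : Fin nQ → List Γ → Str → Maybe (Str × Fin nQ)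
  runPDC q s []      = just ([] , q)
  runPDC q s (b ∷ w) with stepPDC q s b
  ... | nothing = nothing
  ... | just (o , q' , s') with runPDC q' s' w
  ...   | nothing        = nothing
  ...   | just (o' , q'') = just (o ++ o' , q'')

  execPDC : Str → Maybe (Str × Fin nQ)
  execPDC w = runPDC q₀ [ z₀ ] w

  outPDC : Str → Maybe Str
  outPDC w = Data.Maybe.map Data.Product.proj₁ (execPDC w)

ILPDC : {Γ : Set} {z₀ : Γ} → PDC Γ z₀ → Set
ILPDC C = ∀ w w' r → execPDC C w ≡ just r → execPDC C w' ≡ just r → w ≡ w'

data Γ₂ : Set where
  γ0 γ1 γz₀ : Γ₂

data Γ₁ : Set where
  υ0 υz₀ : Γ₁

PushdownCompressor : Set
PushdownCompressor = PDC Γ₂ γz₀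

UnaryPDC : Set
UnaryPDC = PDC Γ₁ υz₀

-- The compressor N reads x and feeds T(x) to C on the fly. Its finite control holds the
-- current states of C and T and a buffer with the top K = L(1 + c) symbols of C's stack, where
-- L bounds the output of T on one bit; its own stack is the rest of C's stack. Before each
-- bit, λ-transitions move symbols from the stack into the buffer until it is full or the
-- bottom marker is on top. On the at most L bits that T then emits, C pops at most L(1 + c)
-- symbols and never the bottom marker, so its run only sees the buffer and the top symbol:
-- N computes it in its control, emits C's output, and pushes onto its stack what does not
-- fit in the buffer. N's final state records the final states of C and T, so N inherits
-- information losslessness from them; and N uses C's own stack alphabet, so unary stacks
-- stay unary.

module Submission where

open import Defs
open import Data.Bool using (false; true)
open import Data.Empty using (⊥; ⊥-elim)
open import Data.Fin as Fin using (Fin; zero; suc; combine; remQuot)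
open import Data.Fin.Properties using (remQuot-combine)
open import Data.List using (List; []; _∷_; _++_; [_]; length; map; take; drop; allFin)
open import Data.List.Extrema.Nat using (max; xs≤max)
open import Data.List.Membership.Propositional using (_∈_)
open import Data.List.Membership.Propositional.Properties using (∈-map⁺; ∈-allFin; ∈-++⁺ˡ; ∈-++⁺ʳ)
open import Data.List.Properties using (++-assoc; length-++; length-take; take++drop≡id)
import Data.List.Relation.Unary.All as All
open import Data.List.Relation.Unary.Any using (here; there)
open import Data.Maybe as M using (Maybe; just; nothing)
open import Data.Maybe.Properties using (map-∘)
import Data.Maybe.Relation.Unary.All as MAll
open import Data.Nat using (ℕ; zero; suc; _+_; _*_; _≤_; _<_; z≤n; s≤s; _<?_)
open import Data.Nat.Properties
  using ( ≤-trans; m≤m+n; m≤n+m; +-comm; +-suc; n≤1+n; n<1+n; n≮n; m+n≤o⇒m≤o; m⊓n≤m; *-monoˡ-≤; ≮⇒≥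
        ; module ≤-Reasoning)
open import Data.Product using (Σ; _×_; _,_; ∃; ∃₂; proj₁; proj₂; map₁; map₂)
open import Data.Sum as Sum using (_⊎_; inj₁; inj₂)
open import Data.Unit using (⊤; tt)
open import Function using (_∘_)
open import Relation.Binary.Definitions using (DecidableEquality)
open import Relation.Binary.PropositionalEquality hiding ([_])
open import Relation.Nullary using (¬_; Dec; yes; no)
open import Relation.Nullary.Decidable using (map′; _×-dec_; ¬?)

map-just⁻ : ∀ {A B : Set} {f : A → B} m {y} → M.map f m ≡ just y →
            ∃ λ x → m ≡ just x × f x ≡ y
map-just⁻ (just x) refl = x , refl , refl

prepend : ∀ {A : Set} → Str → Maybe (Str × A) → Maybe (Str × A)
prepend o = M.map (map₁ (o ++_))

prepend-[] : ∀ {A : Set} (m : Maybe (Str × A)) → prepend [] m ≡ m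
prepend-[] nothing  = refl
prepend-[] (just _) = refl

length-∷ʳ : ∀ {A : Set} (xs : List A) x → length (xs ++ [ x ]) ≡ suc (length xs)
length-∷ʳ xs x = trans (length-++ xs) (+-comm (length xs) 1)

length-∷ʳ≤ : ∀ {A : Set} {n} (xs : List A) x → length xs < n → length (xs ++ [ x ]) ≤ n
length-∷ʳ≤ {n = n} xs x ∣xs∣<n = subst (_≤ n) (sym (length-∷ʳ xs x)) ∣xs∣<n

module Runs {Γ : Set} {z₀ : Γ} (C : PDC Γ z₀) where
  open PDC C

  Q : Set
  Q = Fin nQ

  stack : Str × Q × List Γ → List Γ
  stack = proj₂ ∘ proj₂

  pushUnder : List Γ → Maybe (Str × Q × List Γ) → Maybe (Str × Q × List Γ)
  pushUnder s = M.map (map₂ (map₂ (_++ s)))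

  runWithStack : Q → List Γ → Str → Maybe (Str × Q × List Γ)
  runWithStack q s []      = just ([] , q , s)
  runWithStack q s (b ∷ w) with stepPDC C q s b
  ... | nothing            = nothing
  ... | just (o , q' , s') = prepend o (runWithStack q' s' w)

  lamClose-just : ∀ {q a s q' v} → δ q nothing a ≡ just (q' , v) →
                  lamClose C q (a ∷ s) ≡ lamClose C q' s
  lamClose-just e rewrite e = refl

  lamClose-nothing : ∀ {q a s} → δ q nothing a ≡ nothing → lamClose C q (a ∷ s) ≡ (q , a ∷ s)
  lamClose-nothing e rewrite e = refl

  stepPDC-just : ∀ {q a s b q' v} → δ q (just b) a ≡ just (q' , v) →
                 stepPDC C q (a ∷ s) b ≡ just (ν q (just b) a , lamClose C q' (v ++ s))
  stepPDC-just {s = s} {q' = q'} {v = v} e rewrite e with lamClose C q' (v ++ s)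
  ... | _ , _ = refl

  stepPDC-nothing : ∀ {q a s b} → δ q (just b) a ≡ nothing → stepPDC C q (a ∷ s) b ≡ nothing
  stepPDC-nothing e rewrite e = refl

  runPDC-just : ∀ {q s b o q' s'} w → stepPDC C q s b ≡ just (o , q' , s') →
                runPDC C q s (b ∷ w) ≡ prepend o (runPDC C q' s' w)
  runPDC-just {q' = q'} {s' = s'} w e rewrite e with runPDC C q' s' w
  ... | nothing = refl
  ... | just _  = refl

  runPDC-nothing : ∀ {q s b} w → stepPDC C q s b ≡ nothing → runPDC C q s (b ∷ w) ≡ nothing
  runPDC-nothing w e rewrite e = refl

  runPDC-++-nothing : ∀ {q s} u w → runWithStack q s u ≡ nothing → runPDC C q s (u ++ w) ≡ nothing
  runPDC-++-nothing {q} {s} (b ∷ u) w e with stepPDC C q s b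
  ... | nothing = refl
  ... | just (o , q' , s') with runWithStack q' s' u in e'
  ...   | nothing rewrite runPDC-++-nothing u w e' = refl

  runPDC-++-just : ∀ {q s o q' s'} u w → runWithStack q s u ≡ just (o , q' , s') →
                   runPDC C q s (u ++ w) ≡ prepend o (runPDC C q' s' w)
  runPDC-++-just [] w refl = sym (prepend-[] _)
  runPDC-++-just {q} {s} (b ∷ u) w e with stepPDC C q s b
  runPDC-++-just (b ∷ u) w () | nothing
  ... | just (o₁ , q₁ , s₁) with runWithStack q₁ s₁ u in e'
  runPDC-++-just (b ∷ u) w () | just _ | nothing
  runPDC-++-just {q' = q'} {s' = s'} (b ∷ u) w refl | just (o₁ , _ , _) | just (o₂ , _ , _)
    rewrite runPDC-++-just u w e' with runPDC C q' s' w
  ... | nothing         = refl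
  ... | just (o₃ , q'') = cong (λ x → just (x , q'')) (sym (++-assoc o₁ o₂ o₃))

  lam-undefined-on-bottom : ∀ q → δ q nothing z₀ ≡ nothing
  lam-undefined-on-bottom q with δ q nothing z₀ in e
  ... | nothing = refl
  ... | just (q' , v) with lam-pop q z₀ q' v e | bottom q nothing q' v e
  ...   | refl | [] , ()
  ...   | refl | _ ∷ _ , ()

  lam-top≢z₀ : ∀ {q a q' v} → δ q nothing a ≡ just (q' , v) → ¬ a ≡ z₀
  lam-top≢z₀ {q} e refl with trans (sym e) (lam-undefined-on-bottom q)
  ... | ()

  -- Guarded n p: p has a symbol at depth n, or the bottom marker at depth at most n;
  -- so n pops from the stack p ++ s never expose s.
  Guarded : ℕ → List Γ → Set
  Guarded n       []      = ⊥
  Guarded zero    (a ∷ p) = ⊤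
  Guarded (suc n) (a ∷ p) = a ≡ z₀ ⊎ Guarded n p

  Guarded-mono : ∀ {m n} p → m ≤ n → Guarded n p → Guarded m p
  Guarded-mono {zero}  (a ∷ p) _         _        = tt
  Guarded-mono {suc m} (a ∷ p) (s≤s m≤n) (inj₁ e) = inj₁ e
  Guarded-mono {suc m} (a ∷ p) (s≤s m≤n) (inj₂ g) = inj₂ (Guarded-mono p m≤n g)

  Guarded-++⁺ : ∀ {n} v {p} → Guarded n p → Guarded n (v ++ p)
  Guarded-++⁺         []      g = g
  Guarded-++⁺ {zero}  (a ∷ v) g = tt
  Guarded-++⁺ {suc n} (a ∷ v) g = inj₂ (Guarded-mono (v ++ _) (n≤1+n n) (Guarded-++⁺ v g))

  Guarded-bottom : ∀ n u t → Guarded n (u ++ z₀ ∷ t)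
  Guarded-bottom zero    []      t = tt
  Guarded-bottom (suc n) []      t = inj₁ refl
  Guarded-bottom zero    (a ∷ u) t = tt
  Guarded-bottom (suc n) (a ∷ u) t = inj₂ (Guarded-bottom n u t)

  Guarded-length : ∀ {n} p → n < length p → Guarded n p
  Guarded-length {zero}  (a ∷ p) _         = tt
  Guarded-length {suc n} (a ∷ p) (s≤s n<∣p∣) = inj₂ (Guarded-length p n<∣p∣)

  lamClose-local : ∀ j d q p s → Guarded (j + d) p → ¬ LamChain δ q (p ++ s) (suc j) →
    ∃₂ λ q' p' → lamClose C q p ≡ (q' , p') × lamClose C q (p ++ s) ≡ (q' , p' ++ s) × Guarded d p'
  lamClose-local j d q (a ∷ p) s g ¬chain with δ q nothing a in e
  ... | nothing = q , a ∷ p , refl , refl , Guarded-mono (a ∷ p) (m≤n+m d j) g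
  lamClose-local zero    d q (a ∷ p) s g        ¬chain | just (q' , v) =
    ⊥-elim (¬chain (q' , v , refl , tt))
  lamClose-local (suc j) d q (a ∷ p) s (inj₁ a≡z₀) ¬chain | just (q' , v) =
    ⊥-elim (lam-top≢z₀ e a≡z₀)
  lamClose-local (suc j) d q (a ∷ p) s (inj₂ g) ¬chain | just (q' , v) =
    lamClose-local j d q' p s g (λ chain → ¬chain (q' , v , refl , chain))

  Guarded-replace-top : ∀ {n q x a p q' v} → δ q x a ≡ just (q' , v) →
                        Guarded (suc n) (a ∷ p) → Guarded n (v ++ p)
  Guarded-replace-top {n} {q} {x} {p = p} {q'} {v} e (inj₁ refl) with bottom q x q' v e
  ... | u , refl rewrite ++-assoc u [ z₀ ] p = Guarded-bottom n u p
  Guarded-replace-top {v = v} e (inj₂ g) = Guarded-++⁺ v g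

  stepPDC-local : ∀ d q p s b → Guarded (suc (c + d)) p →
    stepPDC C q (p ++ s) b ≡ pushUnder s (stepPDC C q p b) ×
    MAll.All (Guarded d ∘ stack) (stepPDC C q p b)
  stepPDC-local d q (a ∷ p) s b g with δ q (just b) a in e
  ... | nothing = refl , MAll.nothing
  ... | just (q' , v)
    with lamClose-local c d q' (v ++ p) s (Guarded-replace-top e g) (lam-bound q' _)
  ...   | q'' , p'' , e₁ , e₂ , g'
    rewrite e₁ | sym (++-assoc v p s) | e₂ = refl , MAll.just g'

  runWithStack-local : ∀ u q p s → Guarded (length u * suc c) p →
    runWithStack q (p ++ s) u ≡ pushUnder s (runWithStack q p u)
  runWithStack-local []      q p s g = refl
  runWithStack-local (b ∷ u) q p s g with stepPDC-local (length u * suc c) q p s b g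
  ... | e , g' rewrite e with stepPDC C q p b | g'
  ...   | nothing            | _           = refl
  ...   | just (o , q' , p') | MAll.just g''
    rewrite runWithStack-local u q' p' s g'' with runWithStack q' p' u
  ...     | nothing = refl
  ...     | just _  = refl

  BasedOn : List Γ → List Γ → Set
  BasedOn t s = ∃ λ p → s ≡ p ++ z₀ ∷ t

  lamClose-based : ∀ q p t → BasedOn t (proj₂ (lamClose C q (p ++ z₀ ∷ t)))
  lamClose-based q []      t rewrite lam-undefined-on-bottom q = [] , refl
  lamClose-based q (a ∷ p) t with δ q nothing a
  ... | nothing      = a ∷ p , refl
  ... | just (q' , _) = lamClose-based q' p t

  stepPDC-based : ∀ q p t b → MAll.All (BasedOn t ∘ stack) (stepPDC C q (p ++ z₀ ∷ t) b)
  stepPDC-based q [] t b with δ q (just b) z₀ in e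
  ... | nothing = MAll.nothing
  ... | just (q' , v) with bottom q (just b) q' v e
  ...   | u , refl rewrite ++-assoc u [ z₀ ] t
    with lamClose C q' (u ++ z₀ ∷ t) | lamClose-based q' u t
  ...     | _ , _ | based = MAll.just based
  stepPDC-based q (a ∷ p) t b with δ q (just b) a
  ... | nothing = MAll.nothing
  ... | just (q' , v) rewrite sym (++-assoc v p (z₀ ∷ t))
    with lamClose C q' ((v ++ p) ++ z₀ ∷ t) | lamClose-based q' (v ++ p) t
  ...   | _ , _ | based = MAll.just based

  runWithStack-based : ∀ u q p t → MAll.All (BasedOn t ∘ stack) (runWithStack q (p ++ z₀ ∷ t) u)
  runWithStack-based []      q p t = MAll.just (p , refl)
  runWithStack-based (b ∷ u) q p t with stepPDC C q (p ++ z₀ ∷ t) b | stepPDC-based q p t b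
  ... | nothing            | _ = MAll.nothing
  ... | just (o , q' , s') | MAll.just (p' , refl)
    with runWithStack q' (p' ++ z₀ ∷ t) u | runWithStack-based u q' p' t
  ...   | nothing | _               = MAll.nothing
  ...   | just _  | MAll.just based = MAll.just based

module ListCode {A : Set} {g : ℕ} (toFin : A → Fin g) (fromFin : Fin g → A)
                (fromFin∘toFin : ∀ x → fromFin (toFin x) ≡ x) where

  _≟_ : DecidableEquality A
  x ≟ y = map′ toFin-injective (cong toFin) (toFin x Fin.≟ toFin y)
    where
    toFin-injective : toFin x ≡ toFin y → x ≡ y
    toFin-injective e = trans (sym (fromFin∘toFin x)) (trans (cong fromFin e) (fromFin∘toFin y))

  #Lists≤ : ℕ → ℕ
  #Lists≤ zero    = 1
  #Lists≤ (suc k) = suc (g * #Lists≤ k)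

  encode : (k : ℕ) → List A → Fin (#Lists≤ k)
  encode zero    _       = zero
  encode (suc k) []      = zero
  encode (suc k) (x ∷ l) = suc (combine (toFin x) (encode k l))

  decode : (k : ℕ) → Fin (#Lists≤ k) → List A
  decode zero    _       = []
  decode (suc k) zero    = []
  decode (suc k) (suc i) = let x , j = remQuot (#Lists≤ k) i in fromFin x ∷ decode k j

  decode-encode : ∀ k l → length l ≤ k → decode k (encode k l) ≡ l
  decode-encode zero    []      _ = refl
  decode-encode (suc k) []      _ = refl
  decode-encode (suc k) (x ∷ l) (s≤s ∣l∣≤k) =
    trans (cong (λ (y , j) → fromFin y ∷ decode k j) (remQuot-combine (toFin x) (encode k l)))
          (cong₂ _∷_ (fromFin∘toFin x) (decode-encode k l ∣l∣≤k))

  length-decode : ∀ k i → length (decode k i) ≤ k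
  length-decode zero    _       = z≤n
  length-decode (suc k) zero    = z≤n
  length-decode (suc k) (suc i) = s≤s (length-decode k _)

module Composition {Γ : Set} {z₀ : Γ} {g : ℕ}
  (toFin : Γ → Fin g) (fromFin : Fin g → Γ) (fromFin∘toFin : ∀ x → fromFin (toFin x) ≡ x)
  (C : PDC Γ z₀) (T : FST) where

  open Runs C
  open ListCode toFin fromFin fromFin∘toFin
  module C = PDC C
  module T = FST T

  QT : Set
  QT = Fin T.nQ

  L : ℕ
  L = max 0 (map (λ q → length (T.ν q false) + length (T.ν q true)) (allFin T.nQ))

  length-ν≤L : ∀ q b → length (T.ν q b) ≤ L
  length-ν≤L q b = ≤-trans (length-ν≤ b) (All.lookup (xs≤max 0 _) (∈-map⁺ _ (∈-allFin q)))
    where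
    length-ν≤ : ∀ b → length (T.ν q b) ≤ length (T.ν q false) + length (T.ν q true)
    length-ν≤ false = m≤m+n _ _
    length-ν≤ true  = m≤n+m _ _

  K : ℕ
  K = L * suc C.c

  record Config : Set where
    constructor ⟨_,_,_⟩
    field
      cState : Q
      tState : QT
      buffer : List Γ
  open Config

  State : Set
  State = Fin (C.nQ * (T.nQ * #Lists≤ K))

  encodeConfig : Config → State
  encodeConfig ⟨ qc , qt , buf ⟩ = combine qc (combine qt (encode K buf))

  decodeConfig : State → Config
  decodeConfig i = let qc , j = remQuot {C.nQ} (T.nQ * #Lists≤ K) i
                       qt , k = remQuot {T.nQ} (#Lists≤ K) j
                   in ⟨ qc , qt , decode K k ⟩

  decode-encodeConfig : ∀ {qc qt buf} → length buf ≤ K →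
                        decodeConfig (encodeConfig ⟨ qc , qt , buf ⟩) ≡ ⟨ qc , qt , buf ⟩
  decode-encodeConfig {qc} {qt} {buf} ∣buf∣≤K =
    trans (cong (λ (qc , j) → let qt , k = remQuot {T.nQ} (#Lists≤ K) j in ⟨ qc , qt , decode K k ⟩)
                (remQuot-combine qc (combine qt (encode K buf))))
          (trans (cong (λ (qt , k) → ⟨ qc , qt , decode K k ⟩) (remQuot-combine qt (encode K buf)))
                 (cong ⟨ qc , qt ,_⟩ (decode-encode K buf ∣buf∣≤K)))

  Fills : List Γ → Γ → Set
  Fills buf a = length buf < K × ¬ a ≡ z₀

  fills? : ∀ buf a → Dec (Fills buf a)
  fills? buf a = length buf <? K ×-dec ¬? (a ≟ z₀)

  dropLast : List Γ → List Γ
  dropLast []          = []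
  dropLast (x ∷ [])    = []
  dropLast (x ∷ y ∷ l) = x ∷ dropLast (y ∷ l)

  dropLast-∷ʳ : ∀ p x → dropLast (p ++ [ x ]) ≡ p
  dropLast-∷ʳ []          x = refl
  dropLast-∷ʳ (y ∷ [])    x = refl
  dropLast-∷ʳ (y ∷ z ∷ p) x = cong (y ∷_) (dropLast-∷ʳ (z ∷ p) x)

  -- Splits the segment w that replaced the symbol a on top of C's stack into the part kept
  -- in the buffer and the part pushed on the stack; if a is the bottom marker, so is the
  -- last symbol of w, and it has to stay at the bottom of the pushed part.
  split : Γ → List Γ → List Γ × List Γ
  split a w with a ≟ z₀
  ... | yes _ = take K (dropLast w) , drop K (dropLast w) ++ [ z₀ ]
  ... | no  _ = take K w , drop K w

  settle : QT → Bit → Γ → Str × Q × List Γ → Str × Config × List Γ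
  settle qt b a (o , qc' , w) = o , ⟨ qc' , T.δ qt b , proj₁ (split a w) ⟩ , proj₂ (split a w)

  read : Config → Bit → Γ → Maybe (Str × Config × List Γ)
  read ⟨ qc , qt , buf ⟩ b a = M.map (settle qt b a) (runWithStack qc (buf ++ [ a ]) (T.ν qt b))

  δConfig : Config → Maybe Bit → Γ → Maybe (Config × List Γ)
  δConfig ⟨ qc , qt , buf ⟩ nothing a with fills? buf a
  ... | yes _ = just (⟨ qc , qt , buf ++ [ a ] ⟩ , [])
  ... | no  _ = nothing
  δConfig σ (just b) a with fills? (buffer σ) a
  ... | yes _ = nothing
  ... | no  _ = M.map proj₂ (read σ b a)

  νConfig : Config → Maybe Bit → Γ → Str
  νConfig σ nothing  a = []
  νConfig σ (just b) a = M.maybe′ proj₁ [] (read σ b a)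

  δN : State → Maybe Bit → Γ → Maybe (State × List Γ)
  δN i x a = M.map (map₁ encodeConfig) (δConfig (decodeConfig i) x a)

  δN-encode : ∀ {qc qt buf} x a → length buf ≤ K →
              δN (encodeConfig ⟨ qc , qt , buf ⟩) x a
                ≡ M.map (map₁ encodeConfig) (δConfig ⟨ qc , qt , buf ⟩ x a)
  δN-encode x a ∣buf∣≤K =
    cong (λ σ → M.map (map₁ encodeConfig) (δConfig σ x a)) (decode-encodeConfig ∣buf∣≤K)

  δConfig-pop : ∀ {qc qt buf a} → Fills buf a →
                δConfig ⟨ qc , qt , buf ⟩ nothing a ≡ just (⟨ qc , qt , buf ++ [ a ] ⟩ , [])
  δConfig-pop {buf = buf} {a} f with fills? buf a
  ... | yes _ = refl
  ... | no ¬f = ⊥-elim (¬f f)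

  δConfig-no-pop : ∀ {qc qt buf a} → ¬ Fills buf a → δConfig ⟨ qc , qt , buf ⟩ nothing a ≡ nothing
  δConfig-no-pop {buf = buf} {a} ¬f with fills? buf a
  ... | yes f = ⊥-elim (¬f f)
  ... | no  _ = refl

  δConfig-read : ∀ σ b a → ¬ Fills (buffer σ) a → δConfig σ (just b) a ≡ M.map proj₂ (read σ b a)
  δConfig-read σ b a ¬f with fills? (buffer σ) a
  ... | yes f = ⊥-elim (¬f f)
  ... | no  _ = refl

  δConfig-pop⁻ : ∀ σ a {σ' v} → δConfig σ nothing a ≡ just (σ' , v) →
                 Fills (buffer σ) a × σ' ≡ record σ { buffer = buffer σ ++ [ a ] } × v ≡ []
  δConfig-pop⁻ ⟨ qc , qt , buf ⟩ a e with fills? buf a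
  δConfig-pop⁻ ⟨ qc , qt , buf ⟩ a refl | yes f = f , refl , refl
  δConfig-pop⁻ ⟨ qc , qt , buf ⟩ a ()   | no  _

  δConfig-deterministic : ∀ σ a →
    δConfig σ nothing a ≡ nothing ⊎ (∀ b → δConfig σ (just b) a ≡ nothing)
  δConfig-deterministic ⟨ qc , qt , buf ⟩ a with fills? buf a
  ... | yes _ = inj₂ λ b → refl
  ... | no  _ = inj₁ refl

  split-bottom : ∀ w → ∃ λ u → proj₂ (split z₀ w) ≡ u ++ [ z₀ ]
  split-bottom w with z₀ ≟ z₀
  ... | yes _     = drop K (dropLast w) , refl
  ... | no z₀≢z₀ = ⊥-elim (z₀≢z₀ refl)

  δConfig-bottom : ∀ σ x {σ' v} → δConfig σ x z₀ ≡ just (σ' , v) → ∃ λ u → v ≡ u ++ [ z₀ ]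
  δConfig-bottom σ nothing e with δConfig-pop⁻ σ z₀ e
  ... | (_ , z₀≢z₀) , _ = ⊥-elim (z₀≢z₀ refl)
  δConfig-bottom ⟨ qc , qt , buf ⟩ (just b) e with fills? buf z₀
  δConfig-bottom ⟨ qc , qt , buf ⟩ (just b) () | yes _
  ... | no _ with runWithStack qc (buf ++ [ z₀ ]) (T.ν qt b)
  δConfig-bottom ⟨ qc , qt , buf ⟩ (just b) () | no _ | nothing
  δConfig-bottom ⟨ qc , qt , buf ⟩ (just b) refl | no _ | just (o , qc' , w) = split-bottom w

  lamChain-bounded : ∀ j i s → LamChain δN i s j → j + length (buffer (decodeConfig i)) ≤ K
  lamChain-bounded zero    i s       _ = length-decode K _
  lamChain-bounded (suc j) i (a ∷ s) (i' , v , e , chain)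
    with map-just⁻ (δConfig (decodeConfig i) nothing a) e
  ... | (σ' , _) , e' , refl with δConfig-pop⁻ (decodeConfig i) a e'
  ...   | (∣buf∣<K , _) , refl , refl = begin
    suc j + length buf            ≡⟨ sym (+-suc j _) ⟩
    j + suc (length buf)          ≡⟨ cong (j +_) (sym (length-∷ʳ buf a)) ⟩
    j + length (buf ++ [ a ])     ≡⟨ cong (λ σ → j + length (buffer σ)) decoded ⟨
    j + length (buffer (decodeConfig i'))  ≤⟨ lamChain-bounded j i' s chain ⟩
    K                             ∎
    where
    open ≤-Reasoning
    buf : List Γ
    buf = buffer (decodeConfig i)
    decoded : decodeConfig i' ≡ record (decodeConfig i) { buffer = buf ++ [ a ] }
    decoded = decode-encodeConfig (length-∷ʳ≤ buf a ∣buf∣<K)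

  δN-deterministic : ∀ i a → δN i nothing a ≡ nothing ⊎ (∀ b → δN i (just b) a ≡ nothing)
  δN-deterministic i a = Sum.map (cong (M.map (map₁ encodeConfig)))
                                 (λ e b → cong (M.map (map₁ encodeConfig)) (e b))
                                 (δConfig-deterministic (decodeConfig i) a)

  δN-pop⁻ : ∀ i a {i' v} → δN i nothing a ≡ just (i' , v) → v ≡ []
  δN-pop⁻ i a e with map-just⁻ (δConfig (decodeConfig i) nothing a) e
  ... | _ , e' , refl = proj₂ (proj₂ (δConfig-pop⁻ _ a e'))

  δN-bottom : ∀ i x {i' v} → δN i x z₀ ≡ just (i' , v) → ∃ λ u → v ≡ u ++ [ z₀ ]
  δN-bottom i x e with map-just⁻ (δConfig (decodeConfig i) x z₀) e
  ... | _ , e' , refl = δConfig-bottom _ x e'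

  N : PDC Γ z₀
  N = record
    { nQ        = C.nQ * (T.nQ * #Lists≤ K)
    ; δ         = δN
    ; ν         = λ i → νConfig (decodeConfig i)
    ; q₀        = encodeConfig ⟨ C.q₀ , T.q₀ , [] ⟩
    ; c         = K
    ; det       = δN-deterministic
    ; lam-pop   = λ i a _ _ → δN-pop⁻ i a
    ; lam-out   = λ i a → refl
    ; bottom    = λ i x _ _ → δN-bottom i x
    ; lam-bound = λ i s chain → n≮n K (m+n≤o⇒m≤o (suc K) (lamChain-bounded (suc K) i s chain))
    }

  module RN = Runs N

  Settled : List Γ → List Γ → Set
  Settled buf []      = ⊥
  Settled buf (a ∷ r) = ¬ Fills buf a

  record Invariant (buf r : List Γ) : Set where
    field
      bounded  : length buf ≤ K
      bottomed : z₀ ∈ r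
      settled  : Settled buf r

  ∈-tail : ∀ {a r} → ¬ a ≡ z₀ → z₀ ∈ a ∷ r → z₀ ∈ r
  ∈-tail a≢z₀ (here z₀≡a) = ⊥-elim (a≢z₀ (sym z₀≡a))
  ∈-tail a≢z₀ (there z₀∈r) = z₀∈r

  lamClose-N-settles : ∀ qc qt buf r → length buf ≤ K → z₀ ∈ r →
    ∃₂ λ buf' r' → lamClose N (encodeConfig ⟨ qc , qt , buf ⟩) r
                     ≡ (encodeConfig ⟨ qc , qt , buf' ⟩ , r')
                 × buf' ++ r' ≡ buf ++ r × Invariant buf' r'
  lamClose-N-settles qc qt buf (a ∷ r) ∣buf∣≤K z₀∈ with fills? buf a
  ... | no ¬f = buf , a ∷ r , RN.lamClose-nothing no-pop , refl , record
          { bounded = ∣buf∣≤K ; bottomed = z₀∈ ; settled = ¬f }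
    where
    no-pop : δN (encodeConfig ⟨ qc , qt , buf ⟩) nothing a ≡ nothing
    no-pop = trans (δN-encode nothing a ∣buf∣≤K) (cong (M.map _) (δConfig-no-pop ¬f))
  ... | yes f@(∣buf∣<K , a≢z₀)
    with lamClose-N-settles qc qt (buf ++ [ a ]) r (length-∷ʳ≤ buf a ∣buf∣<K) (∈-tail a≢z₀ z₀∈)
  ...   | buf' , r' , e , eq , inv =
    buf' , r' , trans (RN.lamClose-just pop) e , trans eq (++-assoc buf [ a ] r) , inv
    where
    pop : δN (encodeConfig ⟨ qc , qt , buf ⟩) nothing a
          ≡ just (encodeConfig ⟨ qc , qt , buf ++ [ a ] ⟩ , [])
    pop = trans (δN-encode nothing a ∣buf∣≤K) (cong (M.map _) (δConfig-pop f))

  split-join : ∀ a w → (a ≡ z₀ → BasedOn [] w) → proj₁ (split a w) ++ proj₂ (split a w) ≡ w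
  split-join a w based with a ≟ z₀
  ... | no  _  = take++drop≡id K w
  ... | yes a≡z₀ with based a≡z₀
  ...   | p , refl rewrite dropLast-∷ʳ p z₀ =
    trans (sym (++-assoc (take K p) (drop K p) [ z₀ ])) (cong (_++ [ z₀ ]) (take++drop≡id K p))

  length-split₁ : ∀ a w → length (proj₁ (split a w)) ≤ K
  length-split₁ a w with a ≟ z₀
  ... | yes _ = subst (_≤ K) (sym (length-take K (dropLast w))) (m⊓n≤m K _)
  ... | no  _ = subst (_≤ K) (sym (length-take K w)) (m⊓n≤m K _)

  z₀∈split₂ : ∀ a w r → z₀ ∈ a ∷ r → z₀ ∈ proj₂ (split a w) ++ r
  z₀∈split₂ a w r z₀∈ with a ≟ z₀
  ... | yes _    = ∈-++⁺ˡ (∈-++⁺ʳ (drop K (dropLast w)) (here refl))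
  ... | no a≢z₀ = ∈-++⁺ʳ (drop K w) (∈-tail a≢z₀ z₀∈)

  settled-guarded : ∀ qt b buf a → ¬ Fills buf a → Guarded (length (T.ν qt b) * suc C.c) (buf ++ [ a ])
  settled-guarded qt b buf a ¬f with a ≟ z₀
  ... | yes refl = Guarded-bottom _ buf []
  ... | no a≢z₀  = Guarded-length (buf ++ [ a ]) (begin-strict
    length (T.ν qt b) * suc C.c  ≤⟨ *-monoˡ-≤ (suc C.c) (length-ν≤L qt b) ⟩
    K                            ≤⟨ ≮⇒≥ (λ ∣buf∣<K → ¬f (∣buf∣<K , a≢z₀)) ⟩
    length buf                   <⟨ n<1+n _ ⟩
    suc (length buf)             ≡⟨ length-∷ʳ buf a ⟨
    length (buf ++ [ a ])        ∎)
    where open ≤-Reasoning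

  runWithStack-within-buffer : ∀ qc qt buf a r b → ¬ Fills buf a →
    runWithStack qc (buf ++ a ∷ r) (T.ν qt b) ≡ pushUnder r (runWithStack qc (buf ++ [ a ]) (T.ν qt b))
  runWithStack-within-buffer qc qt buf a r b ¬f =
    subst (λ s → runWithStack qc s (T.ν qt b) ≡ pushUnder r (runWithStack qc (buf ++ [ a ]) (T.ν qt b)))
          (++-assoc buf [ a ] r)
          (runWithStack-local (T.ν qt b) qc (buf ++ [ a ]) r (settled-guarded qt b buf a ¬f))

  δN-read : ∀ qc qt buf a b {m} → length buf ≤ K → ¬ Fills buf a → read ⟨ qc , qt , buf ⟩ b a ≡ m →
            δN (encodeConfig ⟨ qc , qt , buf ⟩) (just b) a ≡ M.map (map₁ encodeConfig ∘ proj₂) m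
  δN-read qc qt buf a b {m} ∣buf∣≤K ¬f refl = begin
    δN (encodeConfig ⟨ qc , qt , buf ⟩) (just b) a                   ≡⟨ δN-encode (just b) a ∣buf∣≤K ⟩
    M.map (map₁ encodeConfig) (δConfig ⟨ qc , qt , buf ⟩ (just b) a) ≡⟨ cong (M.map _) (δConfig-read _ b a ¬f) ⟩
    M.map (map₁ encodeConfig) (M.map proj₂ m)                        ≡⟨ map-∘ m ⟨
    M.map (map₁ encodeConfig ∘ proj₂) m                              ∎
    where open ≡-Reasoning

  stepN-read : ∀ qc qt buf a r b → length buf ≤ K → ¬ Fills buf a →
    stepPDC N (encodeConfig ⟨ qc , qt , buf ⟩) (a ∷ r) b
      ≡ M.map (λ (o , σ , v) → o , lamClose N (encodeConfig σ) (v ++ r)) (read ⟨ qc , qt , buf ⟩ b a)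
  stepN-read qc qt buf a r b ∣buf∣≤K ¬f with read ⟨ qc , qt , buf ⟩ b a in e
  ... | nothing          = RN.stepPDC-nothing (δN-read qc qt buf a b ∣buf∣≤K ¬f e)
  ... | just (o , σ , v) = trans (RN.stepPDC-just (δN-read qc qt buf a b ∣buf∣≤K ¬f e))
                                 (cong (λ o → just (o , lamClose N (encodeConfig σ) (v ++ r))) ν≡o)
    where
    ν≡o : νConfig (decodeConfig (encodeConfig ⟨ qc , qt , buf ⟩)) (just b) a ≡ o
    ν≡o = trans (cong (λ σ → νConfig σ (just b) a) (decode-encodeConfig ∣buf∣≤K))
                (cong (M.maybe′ proj₁ []) e)

  stepN-simulates : ∀ qc qt buf a r b → Invariant buf (a ∷ r) →
      (stepPDC N (encodeConfig ⟨ qc , qt , buf ⟩) (a ∷ r) b ≡ nothing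
       × runWithStack qc (buf ++ a ∷ r) (T.ν qt b) ≡ nothing)
    ⊎ ∃₂ λ o qc' → ∃₂ λ buf' r' →
         stepPDC N (encodeConfig ⟨ qc , qt , buf ⟩) (a ∷ r) b
           ≡ just (o , encodeConfig ⟨ qc' , T.δ qt b , buf' ⟩ , r')
       × runWithStack qc (buf ++ a ∷ r) (T.ν qt b) ≡ just (o , qc' , buf' ++ r')
       × Invariant buf' r'
  stepN-simulates qc qt buf a r b inv
    rewrite stepN-read qc qt buf a r b (Invariant.bounded inv) (Invariant.settled inv)
          | runWithStack-within-buffer qc qt buf a r b (Invariant.settled inv)
    with runWithStack qc (buf ++ [ a ]) (T.ν qt b) in e
  ... | nothing = inj₁ (refl , refl)
  ... | just (o , qc' , w)
    with lamClose-N-settles qc' (T.δ qt b) (proj₁ (split a w)) (proj₂ (split a w) ++ r)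
                (length-split₁ a w) (z₀∈split₂ a w r (Invariant.bottomed inv))
  ...   | buf' , r' , e' , eq , inv' rewrite e' =
    inj₂ (o , qc' , buf' , r' , refl , cong (λ s → just (o , qc' , s)) w++r≡buf'++r' , inv')
    where
    based : a ≡ z₀ → BasedOn [] w
    based refl = MAll.drop-just (subst (MAll.All (BasedOn [] ∘ stack)) e
                                       (runWithStack-based (T.ν qt b) qc buf []))

    w++r≡buf'++r' : w ++ r ≡ buf' ++ r'
    w++r≡buf'++r' = begin
      w ++ r                                              ≡⟨ cong (_++ r) (split-join a w based) ⟨
      (proj₁ (split a w) ++ proj₂ (split a w)) ++ r       ≡⟨ ++-assoc (proj₁ (split a w)) _ r ⟩
      proj₁ (split a w) ++ proj₂ (split a w) ++ r         ≡⟨ eq ⟨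
      buf' ++ r'                                          ∎
      where open ≡-Reasoning

  Agrees : Maybe (Str × State) → Maybe (Str × Q) → QT → Set
  Agrees nothing        m qt = m ≡ nothing
  Agrees (just (o , i)) m qt = m ≡ just (o , cState (decodeConfig i)) × tState (decodeConfig i) ≡ qt

  Agrees-prepend : ∀ o {m m' qt} → Agrees m m' qt → Agrees (prepend o m) (prepend o m') qt
  Agrees-prepend o {nothing} refl = refl
  Agrees-prepend o {just _}  (refl , eq) = refl , eq

  runFST-∷ : ∀ qt b x → runFST T qt (b ∷ x) ≡ map₁ (T.ν qt b ++_) (runFST T (T.δ qt b) x)
  runFST-∷ qt b x with runFST T (T.δ qt b) x
  ... | _ , _ = refl

  runPDC-N-simulates : ∀ x qc qt buf r → Invariant buf r →
    Agrees (runPDC N (encodeConfig ⟨ qc , qt , buf ⟩) r x)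
           (runPDC C qc (buf ++ r) (proj₁ (runFST T qt x)))
           (proj₂ (runFST T qt x))
  runPDC-N-simulates [] qc qt buf r inv =
    cong (λ σ → just ([] , cState σ)) (sym decoded) , cong tState decoded
    where
    decoded : decodeConfig (encodeConfig ⟨ qc , qt , buf ⟩) ≡ ⟨ qc , qt , buf ⟩
    decoded = decode-encodeConfig (Invariant.bounded inv)
  runPDC-N-simulates (b ∷ x) qc qt buf [] inv = ⊥-elim (Invariant.settled inv)
  runPDC-N-simulates (b ∷ x) qc qt buf (a ∷ r) inv
    rewrite runFST-∷ qt b x with stepN-simulates qc qt buf a r b inv
  ... | inj₁ (stepN≡nothing , runC≡nothing)
    rewrite RN.runPDC-nothing x stepN≡nothing = runPDC-++-nothing (T.ν qt b) _ runC≡nothing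
  ... | inj₂ (o , qc' , buf' , r' , stepN≡ , runC≡ , inv')
    rewrite RN.runPDC-just x stepN≡ | runPDC-++-just (T.ν qt b) (proj₁ (runFST T (T.δ qt b) x)) runC≡ =
    Agrees-prepend o (runPDC-N-simulates x qc' (T.δ qt b) buf' r' inv')

  execPDC-N-simulates : ∀ x → Agrees (execPDC N x) (execPDC C (fstOut T x)) (fstState T x)
  execPDC-N-simulates x = runPDC-N-simulates x C.q₀ T.q₀ [] [ z₀ ] record
    { bounded = z≤n ; bottomed = here refl ; settled = λ (_ , z₀≢z₀) → z₀≢z₀ refl }

  lossless-composition : ILPDC C → ILFST T →
    Σ (PDC Γ z₀) λ N → ILPDC N × (∀ x → outPDC N x ≡ outPDC C (fstOut T x))
  lossless-composition C-lossless T-lossless = N , N-lossless , λ x → same-output (execPDC-N-simulates x)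
    where
    same-output : ∀ {m m' qt} → Agrees m m' qt → M.map proj₁ m ≡ M.map proj₁ m'
    same-output {nothing} refl      = refl
    same-output {just _}  (refl , _) = refl

    N-lossless : ILPDC N
    N-lossless w w' (o , i) e e'
      with subst (λ m → Agrees m _ _) e (execPDC-N-simulates w)
         | subst (λ m → Agrees m _ _) e' (execPDC-N-simulates w')
    ... | runC≡ , qt≡ | runC≡' , qt≡' =
      T-lossless w w' (C-lossless _ _ (o , cState (decodeConfig i)) runC≡ runC≡') (trans (sym qt≡) qt≡')

toFin₂ : Γ₂ → Fin 3
toFin₂ γ0  = zero
toFin₂ γ1  = suc zero
toFin₂ γz₀ = suc (suc zero)

fromFin₂ : Fin 3 → Γ₂
fromFin₂ zero             = γ0
fromFin₂ (suc zero)       = γ1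
fromFin₂ (suc (suc zero)) = γz₀

fromFin₂∘toFin₂ : ∀ x → fromFin₂ (toFin₂ x) ≡ x
fromFin₂∘toFin₂ γ0  = refl
fromFin₂∘toFin₂ γ1  = refl
fromFin₂∘toFin₂ γz₀ = refl

toFin₁ : Γ₁ → Fin 2
toFin₁ υ0  = zero
toFin₁ υz₀ = suc zero

fromFin₁ : Fin 2 → Γ₁
fromFin₁ zero       = υ0
fromFin₁ (suc zero) = υz₀

fromFin₁∘toFin₁ : ∀ x → fromFin₁ (toFin₁ x) ≡ x
fromFin₁∘toFin₁ υ0  = refl
fromFin₁∘toFin₁ υz₀ = refl

lemma6 : ((C : PushdownCompressor) (T : FST) → ILPDC C → ILFST T →
            Σ PushdownCompressor λ N → ILPDC N × (∀ x → outPDC N x ≡ outPDC C (fstOut T x)))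
       × ((C : UnaryPDC) (T : FST) → ILPDC C → ILFST T →
            Σ UnaryPDC λ N → ILPDC N × (∀ x → outPDC N x ≡ outPDC C (fstOut T x)))
lemma6 = (λ C T → Composition.lossless-composition toFin₂ fromFin₂ fromFin₂∘toFin₂ C T)
       , (λ C T → Composition.lossless-composition toFin₁ fromFin₁ fromFin₁∘toFin₁ C T)
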